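{- The logic $\mathbf{PM3}$ does not have projective unification: there exists a formula that is unifiable in $\mathbf{PM3}$ but is not projective in $\mathbf{PM3}$ (for instance $\Box(\Box x_1\to x_2)\vee\Box(\Box x_2\to x_1)$).
   Context: $\mathbf{PM3}$ is the normal modal logic (extension of $\mathcal{S}4$) of all finite Kripke frames $\langle\{0,1,\dots,m+1\},R\rangle$, $m\ge1$, with $xRy\iff(x=0\ \text{or}\ y=m+1\ \text{or}\ 1\le x=y\le m)$. A formula $\varphi(p_1,\dots,p_s)$ is unifiable in a logic $\mathcal{L}$ if some substitution $\sigma$ gives $\sigma(\varphi)\in\mathcal{L}$. $\varphi$ is projective in $\mathcal{L}$ if there is a unifier $\tau$ of $\varphi$ in $\mathcal{L}$ such that $\Box\varphi\to(p_i\leftrightarrow\tau(p_i))\in\mathcal{L}$ for every variable $p_i$ of $\varphi$. $\mathcal{L}$ has projective unification if every formula unifiable in $\mathcal{L}$ is projective in $\mathcal{L}$. -}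

module Defs where

open import Data.Nat using (ℕ; zero; suc; _≤_; _≡ᵇ_; _≤ᵇ_)
open import Data.Fin using (Fin; toℕ)
open import Data.Bool using (Bool; true; false; _∧_; _∨_; not)
open import Data.List using (List; []; _∷_; _++_)
open import Data.List.Membership.Propositional using (_∈_)
open import Data.Product using (Σ; _×_)
open import Relation.Binary.PropositionalEquality using (_≡_)

infixr 5 _⇒_
infixr 6 _∨ᶠ_
infixr 7 _∧ᶠ_
data Formula : Set where
  var  : ℕ → Formula
  ⊥ᶠ   : Formula
  _⇒_  : Formula → Formula → Formula
  _∧ᶠ_ : Formula → Formula → Formula
  _∨ᶠ_ : Formula → Formula → Formula
  □_   : Formula → Formula

_⇔_ : Formula → Formula → Formula
φ ⇔ ψ = (φ ⇒ ψ) ∧ᶠ (ψ ⇒ φ)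

Substitution : Set
Substitution = ℕ → Formula

subst : Substitution → Formula → Formula
subst σ (var i)  = σ i
subst σ ⊥ᶠ       = ⊥ᶠ
subst σ (φ ⇒ ψ)  = subst σ φ ⇒ subst σ ψ
subst σ (φ ∧ᶠ ψ) = subst σ φ ∧ᶠ subst σ ψ
subst σ (φ ∨ᶠ ψ) = subst σ φ ∨ᶠ subst σ ψ
subst σ (□ φ)    = □ subst σ φ

vars : Formula → List ℕ
vars (var i)  = i ∷ []
vars ⊥ᶠ       = []
vars (φ ⇒ ψ)  = vars φ ++ vars ψ
vars (φ ∧ᶠ ψ) = vars φ ++ vars ψ
vars (φ ∨ᶠ ψ) = vars φ ++ vars ψ
vars (□ φ)    = vars φ

World : ℕ → Set
World m = Fin (suc (suc m))

R : (m : ℕ) → World m → World m → Bool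
R m x y = (toℕ x ≡ᵇ 0) ∨ (toℕ y ≡ᵇ suc m)
          ∨ ((1 ≤ᵇ toℕ x) ∧ (toℕ x ≡ᵇ toℕ y) ∧ (toℕ x ≤ᵇ m))

allFin : (n : ℕ) → (Fin n → Bool) → Bool
allFin zero    f = true
allFin (suc n) f = f Fin.zero ∧ allFin n (λ i → f (Fin.suc i))

Valuation : ℕ → Set
Valuation m = ℕ → World m → Bool

eval : (m : ℕ) → Valuation m → Formula → World m → Bool
eval m V (var i)  x = V i x
eval m V ⊥ᶠ       x = false
eval m V (φ ⇒ ψ)  x = not (eval m V φ x) ∨ eval m V ψ x
eval m V (φ ∧ᶠ ψ) x = eval m V φ x ∧ eval m V ψ x
eval m V (φ ∨ᶠ ψ) x = eval m V φ x ∨ eval m V ψ x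
eval m V (□ φ)    x = allFin (suc (suc m)) (λ y → not (R m x y) ∨ eval m V φ y)

InPM3 : Formula → Set
InPM3 φ = (m : ℕ) → 1 ≤ m → (V : Valuation m) → (x : World m) → eval m V φ x ≡ true

Unifiable : Formula → Set
Unifiable φ = Σ Substitution (λ σ → InPM3 (subst σ φ))

Projective : Formula → Set
Projective φ = Σ Substitution (λ τ →
  InPM3 (subst τ φ) × ((i : ℕ) → i ∈ vars φ → InPM3 (□ φ ⇒ (var i ⇔ τ i))))

HasProjectiveUnification : Set
HasProjectiveUnification = (φ : Formula) → Unifiable φ → Projective φ

-- Substituting ⊤ for every variable unifies φ₀.
-- On the frame F₂ (root 0, incomparable points 1 and 2, top 3) let p₁ hold at 1, 3 and
-- p₂ at 2, 3. Then □φ₀ holds at 1, 2 and 3, so a projective unifier τ would have to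
-- leave the values of p₁ and p₂ unchanged there. But with these values above the root
-- φ₀ fails at 0 whatever p₁ and p₂ are at 0, while τ(φ₀) is valid.
module Submission where

open import Defs
open import Data.Bool using (Bool; true; false; _∧_; _∨_; not)
open import Data.Bool.Properties using (∨-zeroʳ)
open import Data.Fin using (Fin; zero; suc)
open import Data.List.Membership.Propositional using (_∈_)
open import Data.List.Relation.Unary.Any using (here; there)
open import Data.Nat using (ℕ; _≤_; s≤s; z≤n)
open import Data.Product using (Σ; _×_; _,_)
open import Relation.Binary.PropositionalEquality
  using (_≡_; refl; sym; trans; cong; cong₂; module ≡-Reasoning)
open ≡-Reasoning
open import Relation.Nullary using (¬_; contradiction)

allFin-true : ∀ n (f : Fin n → Bool) → (∀ y → f y ≡ true) → allFin n f ≡ true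
allFin-true ℕ.zero    f h = refl
allFin-true (ℕ.suc n) f h rewrite h zero = allFin-true n (λ y → f (suc y)) (λ y → h (suc y))

allFin-cong : ∀ n {f g : Fin n → Bool} → (∀ y → f y ≡ g y) → allFin n f ≡ allFin n g
allFin-cong ℕ.zero    h = refl
allFin-cong (ℕ.suc n) h = cong₂ _∧_ (h zero) (allFin-cong n (λ y → h (suc y)))

necessitation : ∀ m V φ (x : World m) → (∀ y → eval m V φ y ≡ true) → eval m V (□ φ) x ≡ true
necessitation m V φ x h =
  allFin-true _ _ (λ y → trans (cong (not (R m x y) ∨_) (h y)) (∨-zeroʳ _))

eval-cong : ∀ m {V W : Valuation m} → (∀ i x → V i x ≡ W i x) →
            ∀ φ x → eval m V φ x ≡ eval m W φ x
eval-cong m h (var i)  x = h i x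
eval-cong m h ⊥ᶠ       x = refl
eval-cong m h (φ ⇒ ψ)  x = cong₂ (λ a b → not a ∨ b) (eval-cong m h φ x) (eval-cong m h ψ x)
eval-cong m h (φ ∧ᶠ ψ) x = cong₂ _∧_ (eval-cong m h φ x) (eval-cong m h ψ x)
eval-cong m h (φ ∨ᶠ ψ) x = cong₂ _∨_ (eval-cong m h φ x) (eval-cong m h ψ x)
eval-cong m h (□ φ)    x = allFin-cong _ (λ y → cong (not (R m x y) ∨_) (eval-cong m h φ y))

_⊚_ : ∀ {m} → Valuation m → Substitution → Valuation m
(V ⊚ τ) i x = eval _ V (τ i) x

eval-subst : ∀ m V τ φ (x : World m) → eval m V (subst τ φ) x ≡ eval m (V ⊚ τ) φ x
eval-subst m V τ (var i)  x = refl
eval-subst m V τ ⊥ᶠ       x = refl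
eval-subst m V τ (φ ⇒ ψ)  x = cong₂ (λ a b → not a ∨ b) (eval-subst m V τ φ x) (eval-subst m V τ ψ x)
eval-subst m V τ (φ ∧ᶠ ψ) x = cong₂ _∧_ (eval-subst m V τ φ x) (eval-subst m V τ ψ x)
eval-subst m V τ (φ ∨ᶠ ψ) x = cong₂ _∨_ (eval-subst m V τ φ x) (eval-subst m V τ ψ x)
eval-subst m V τ (□ φ)    x = allFin-cong _ (λ y → cong (not (R m x y) ∨_) (eval-subst m V τ φ y))

InPM3-subst⇒true : ∀ τ φ → InPM3 (subst τ φ) →
                   ∀ m → 1 ≤ m → (V : Valuation m) (x : World m) → eval m (V ⊚ τ) φ x ≡ true
InPM3-subst⇒true τ φ valid m 1≤m V x = trans (sym (eval-subst m V τ φ x)) (valid m 1≤m V x)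

InPM3-□⇒⇔ : ∀ φ i ψ → InPM3 (□ φ ⇒ (var i ⇔ ψ)) →
             ∀ m → 1 ≤ m → (V : Valuation m) (x : World m) →
             eval m V (□ φ) x ≡ true → V i x ≡ eval m V ψ x
InPM3-□⇒⇔ φ i ψ valid m 1≤m V x □φ with eval m V (□ φ) x | □φ | valid m 1≤m V x
... | true | refl | equiv = ⇔-true (V i x) (eval m V ψ x) equiv
  where
  ⇔-true : ∀ a b → (not a ∨ b) ∧ (not b ∨ a) ≡ true → a ≡ b
  ⇔-true false false _ = refl
  ⇔-true true  true  _ = refl

⊤ᶠ : Formula
⊤ᶠ = ⊥ᶠ ⇒ ⊥ᶠ

φ₀ : Formula
φ₀ = □ (□ var 1 ⇒ var 2) ∨ᶠ □ (□ var 2 ⇒ var 1)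

φ₀-unifiable : Unifiable φ₀
φ₀-unifiable = (λ _ → ⊤ᶠ) , valid
  where
  valid : InPM3 (subst (λ _ → ⊤ᶠ) φ₀)
  valid m _ V x rewrite necessitation m V (□ ⊤ᶠ ⇒ ⊤ᶠ) x (λ y → ∨-zeroʳ _) = refl

1≤2 : 1 ≤ 2
1≤2 = s≤s z≤n

root : World 2
root = zero

V₀ : Valuation 2
V₀ 1 (suc zero)             = true
V₀ 2 (suc (suc zero))       = true
V₀ _ (suc (suc (suc zero))) = true
V₀ _ _                      = false

□φ₀-above-root : ∀ y → eval 2 V₀ (□ φ₀) (suc y) ≡ true
□φ₀-above-root zero             = refl
□φ₀-above-root (suc zero)       = refl
□φ₀-above-root (suc (suc zero)) = refl

V₀-above-root : Valuation 2 → Valuation 2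
V₀-above-root W 1 (suc y) = V₀ 1 (suc y)
V₀-above-root W 2 (suc y) = V₀ 2 (suc y)
V₀-above-root W i x       = W i x

φ₀-fails-at-root-of-V₀-above-root : ∀ W → eval 2 (V₀-above-root W) φ₀ root ≡ false
φ₀-fails-at-root-of-V₀-above-root W with W 1 root | W 2 root
... | false | false = refl
... | false | true  = refl
... | true  | false = refl
... | true  | true  = refl

V₀-above-root-agrees : ∀ W → (∀ i y → i ∈ vars φ₀ → W i (suc y) ≡ V₀ i (suc y)) →
                       ∀ i x → V₀-above-root W i x ≡ W i x
V₀-above-root-agrees W agree 1 (suc y) = sym (agree 1 y (here refl))
V₀-above-root-agrees W agree 2 (suc y) = sym (agree 2 y (there (here refl)))
V₀-above-root-agrees W agree 1 zero    = refl
V₀-above-root-agrees W agree 2 zero    = refl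
V₀-above-root-agrees W agree 0 x       = refl
V₀-above-root-agrees W agree (ℕ.suc (ℕ.suc (ℕ.suc i))) x = refl

φ₀-not-projective : ¬ Projective φ₀
φ₀-not-projective (τ , unifier , projective) = contradiction false≡true λ ()
  where
  W : Valuation 2
  W = V₀ ⊚ τ

  fixed-above-root : ∀ i y → i ∈ vars φ₀ → W i (suc y) ≡ V₀ i (suc y)
  fixed-above-root i y i∈ =
    sym (InPM3-□⇒⇔ φ₀ i (τ i) (projective i i∈) 2 1≤2 V₀ (suc y) (□φ₀-above-root y))

  false≡true : false ≡ true
  false≡true = begin
    false                              ≡⟨ sym (φ₀-fails-at-root-of-V₀-above-root W) ⟩
    eval 2 (V₀-above-root W) φ₀ root   ≡⟨ eval-cong 2 (V₀-above-root-agrees W fixed-above-root) φ₀ root ⟩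
    eval 2 W φ₀ root                   ≡⟨ InPM3-subst⇒true τ φ₀ unifier 2 1≤2 V₀ root ⟩
    true                               ∎

lemma5 : Σ Formula (λ φ → Unifiable φ × ¬ Projective φ)
lemma5 = φ₀ , φ₀-unifiable , φ₀-not-projective
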